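{- For all integers $m\ge1$ and $k\ge2$, $B(m,k)\ge \lfloor k/2\rfloor\,(m-k+1)+k-1$.
   Context: For a point $p\in\mathbb{R}^2$ write $x(p),y(p)$ for its coordinates. A finite set of points with distinct $x$-coordinates, listed as $p_1,\dots,p_n$ with $x(p_1)<\dots<x(p_n)$, is an $n$-up-run if $y(p_i)\le y(p_{i+1})$ for all $1\le i\le n-1$. The game $B_{m,k}$ ($k\ge2$): in each turn, player A chooses a value $\hat x\in(0,1)$ and then player B chooses a value $\hat y\in\{1,2,\dots,k-1\}$, forming the point $(\hat x,\hat y)$. Player A's objective is to force the set of played points to contain an $m$-up-run, and player B's is to avoid this. $B(m,k)$ denotes the minimum number of turns in which player A can force an $m$-up-run, against any play of player B. -}

module Defs where

open import Data.Nat using (ℕ; zero; suc; _≤_; _∸_)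
open import Data.Fin using (Fin)
open import Data.List using (List; []; length; insertAt)
open import Data.List.Relation.Binary.Sublist.Propositional using (_⊆_)
open import Data.List.Relation.Unary.Linked using (Linked)
open import Data.Product using (∃; _×_)
open import Relation.Binary.PropositionalEquality using (_≡_)

-- A position (set of played points) is recorded as the list of the
-- y-coordinates of the points, listed in increasing order of x.
-- Only the relative x-order matters, and since (0,1) is dense, player A's
-- choice of x̂ amounts to choosing an insertion position among the
-- existing points.

HasUpRun : ℕ → List ℕ → Set
HasUpRun m ys = ∃ λ zs → zs ⊆ ys × length zs ≡ m × Linked _≤_ zs

-- AForces m k n s : in the game B_{m,k}, starting from position s,
-- player A can force an m-up-run within at most n further turns.
data AForces (m k : ℕ) : ℕ → List ℕ → Set where
  done : ∀ {n s} → HasUpRun m s → AForces m k n s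
  move : ∀ {n s} (i : Fin (suc (length s))) →
         (∀ y → 1 ≤ y → y ≤ k ∸ 1 → AForces m k n (insertAt s i y)) →
         AForces m k (suc n) s

{-# OPTIONS --safe #-}
module Submission where

-- Player B keeps the position d-separated, where d = ⌊k/2⌋ − 1: any two
-- points at most d apart in x-order get different values.  This is possible
-- because a new point has at most 2d < k − 1 points within distance d of it.
-- In an up-run of length L with values in {1, …, k−1} at most k − 2 steps go
-- up, so at least L − (k − 1) steps repeat a value, and in a d-separated
-- position each repetition skips at least d points.  Hence a position of N
-- points only contains up-runs with (d + 1) L ≤ N + d (k − 1).  Each turn adds
-- one point, so A needs at least (d + 1) m − d (k − 1) = ⌊k/2⌋(m−k+1)+k−1 turns.

open import Defs
open import Data.Nat using (ℕ; zero; suc; _≤_; _<_; _∸_; _/_; z≤n; s≤s; z<s; _≟_)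
open import Data.Nat.Properties using (n≤1+n; suc-injective; *-suc; *-identityʳ)
open import Data.Fin using (Fin; zero; suc; toℕ)
open import Data.Fin.Properties using (pigeonhole; ¬∀⟶∃¬; toℕ<n; toℕ-injective; <-irrefl)
open import Data.List using (List; []; _∷_; length; take; insertAt; lookup)
open import Data.List.Properties using (length-insertAt; length-take)
open import Data.List.Membership.Propositional using (_∈_; _∉_)
open import Data.List.Membership.DecPropositional _≟_ using (_∈?_)
open import Data.List.Relation.Unary.All as All using (All; []; _∷_)
open import Data.List.Relation.Unary.All.Properties using (¬Any⇒All¬)
open import Data.List.Relation.Unary.Any using (index)
open import Data.List.Relation.Unary.Any.Properties using (lookup-index)
open import Data.List.Relation.Unary.Linked using (Linked; _∷_)
open import Data.List.Relation.Binary.Sublist.Propositional using (_⊆_; _∷ʳ_; _∷_)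
open import Data.List.Relation.Binary.Sublist.Propositional.Properties as Sublist using (All-resp-⊆)
open import Data.Product using (∃; _×_; _,_; proj₁; proj₂)
open import Data.Sum using (inj₁; inj₂)
open import Function using (_∘_)
open import Relation.Nullary using (¬_; yes; no; contradiction)
open import Relation.Binary.PropositionalEquality

fresh-value : ∀ K (xs : List ℕ) → length xs < K → ∃ λ y → (1 ≤ y × y ≤ K) × y ∉ xs
fresh-value K xs |xs|<K with ¬∀⟶∃¬ K (λ i → suc (toℕ i) ∈ xs) (λ i → suc (toℕ i) ∈? xs) not-all
  where
  not-all : ¬ (∀ i → suc (toℕ i) ∈ xs)
  not-all all with pigeonhole |xs|<K (index ∘ all)
  ... | i , j , i<j , same-index = <-irrefl (toℕ-injective (suc-injective same-value)) i<j
    where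
    same-value : suc (toℕ i) ≡ suc (toℕ j)
    same-value = begin
      suc (toℕ i)                ≡⟨ lookup-index (all i) ⟩
      lookup xs (index (all i))  ≡⟨ cong (lookup xs) same-index ⟩
      lookup xs (index (all j))  ≡⟨ sym (lookup-index (all j)) ⟩
      suc (toℕ j)                ∎
      where open ≡-Reasoning
... | i , i∉xs = suc (toℕ i) , (s≤s z≤n , toℕ<n i) , i∉xs

All-take-insertAt : ∀ {A : Set} {P : A → Set} n (xs : List A) i {y} →
  All P (take n xs) → (toℕ i < n → P y) → All P (take n (insertAt xs i y))
All-take-insertAt zero    xs       i       _          _  = []
All-take-insertAt (suc n) xs       zero    pxs        py = py z<s ∷ All-resp-⊆ (Sublist.take⁺ (n≤1+n n)) pxs
All-take-insertAt (suc n) (x ∷ xs) (suc i) (px ∷ pxs) py = px ∷ All-take-insertAt n xs i pxs (py ∘ s≤s)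

All-insertAt : ∀ {A : Set} {P : A → Set} (xs : List A) i {y} → All P xs → P y → All P (insertAt xs i y)
All-insertAt xs       zero    pxs        py = py ∷ pxs
All-insertAt (x ∷ xs) (suc i) (px ∷ pxs) py = px ∷ All-insertAt xs i pxs py

module Separation (d : ℕ) where

  open import Data.Nat using (_+_; _*_; _⊓_; _<?_)
  open import Data.Nat.Properties

  data Separated : List ℕ → Set where
    []  : Separated []
    _∷_ : ∀ {x xs} → All (x ≢_) (take d xs) → Separated xs → Separated (x ∷ xs)

  -- The values within distance d of a point inserted at position i: the point
  -- x passed over in the recursive case lies at distance toℕ i + 1 from it.
  nearby : (xs : List ℕ) → Fin (suc (length xs)) → List ℕ
  nearby xs       zero    = take d xs
  nearby (x ∷ xs) (suc i) with toℕ i <? d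
  ... | yes _ = x ∷ nearby xs i
  ... | no  _ = nearby xs i

  length-nearby : ∀ xs i → length (nearby xs i) ≤ d + toℕ i ⊓ d
  length-nearby xs zero = begin
    length (take d xs) ≡⟨ length-take d xs ⟩
    d ⊓ length xs      ≤⟨ m⊓n≤m d (length xs) ⟩
    d                  ≤⟨ m≤m+n d 0 ⟩
    d + 0              ∎
    where open ≤-Reasoning
  length-nearby (x ∷ xs) (suc i) with toℕ i <? d
  ... | yes i<d = begin
    suc (length (nearby xs i)) ≤⟨ s≤s (length-nearby xs i) ⟩
    suc (d + toℕ i ⊓ d)        ≡⟨ cong (λ t → suc (d + t)) (m≤n⇒m⊓n≡m (<⇒≤ i<d)) ⟩
    suc (d + toℕ i)            ≡⟨ sym (+-suc d (toℕ i)) ⟩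
    d + suc (toℕ i)            ≡⟨ cong (d +_) (sym (m≤n⇒m⊓n≡m i<d)) ⟩
    d + suc (toℕ i) ⊓ d        ∎
    where open ≤-Reasoning
  ... | no _ = ≤-trans (length-nearby xs i) (+-monoʳ-≤ d (⊓-monoˡ-≤ d (n≤1+n (toℕ i))))

  length-nearby≤d+d : ∀ xs i → length (nearby xs i) ≤ d + d
  length-nearby≤d+d xs i = ≤-trans (length-nearby xs i) (+-monoʳ-≤ d (m⊓n≤n (toℕ i) d))

  insertAt-separated : ∀ xs i {y} → Separated xs → All (y ≢_) (nearby xs i) → Separated (insertAt xs i y)
  insertAt-separated xs zero sep y∉ = y∉ ∷ sep
  insertAt-separated (x ∷ xs) (suc i) (x∉ ∷ sep) y∉ with toℕ i <? d
  ... | yes _ = All-take-insertAt d xs i x∉ (λ _ → ≢-sym (All.head y∉)) ∷ insertAt-separated xs i sep (All.tail y∉)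
  ... | no i≮d = All-take-insertAt d xs i x∉ (λ i<d → contradiction i<d i≮d) ∷ insertAt-separated xs i sep y∉

  -- At most K − z steps of the run raise the value, so at least
  -- length zs − (K − z) of them repeat it, and after each repetition
  -- separation makes the run skip d points of xs.  The j leading points of xs
  -- differ from z, so they are skipped before z is reached.
  run-bound : ∀ {K} j {z zs xs} → z ∷ zs ⊆ xs → Linked _≤_ (z ∷ zs) → All (z ≢_) (take j xs) →
              Separated xs → All (_≤ K) xs → j + length (z ∷ zs) + d * (length zs + z) ≤ length xs + d * K
  run-bound zero    (_ ∷ʳ p) run _ (_ ∷ sep) (_ ∷ xs≤K) = m≤n⇒m≤1+n (run-bound 0 p run [] sep xs≤K)
  run-bound (suc j) (_ ∷ʳ p) run (_ ∷ z∉) (_ ∷ sep) (_ ∷ xs≤K) = s≤s (run-bound j p run z∉ sep xs≤K)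
  run-bound (suc j) (refl ∷ _) _ (z≢z ∷ _) _ _ = contradiction refl z≢z
  run-bound {K} zero {z} {[]} {_ ∷ xs} (refl ∷ _) _ _ _ (z≤K ∷ _) =
    s≤s (≤-trans (*-monoʳ-≤ d z≤K) (m≤n+m (d * K) (length xs)))
  run-bound {K} zero {z} {z′ ∷ zs} {_ ∷ xs} (refl ∷ p) (z≤z′ ∷ run) _ (z∉ ∷ sep) (_ ∷ xs≤K)
    with m≤n⇒m<n∨m≡n z≤z′
  ... | inj₁ z<z′ = s≤s (begin
    suc n + d * (suc n + z) ≤⟨ +-monoʳ-≤ (suc n) (*-monoʳ-≤ d raise) ⟩
    suc n + d * (n + z′)    ≤⟨ run-bound 0 p run [] sep xs≤K ⟩
    length xs + d * K       ∎)
    where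
    open ≤-Reasoning
    n : ℕ
    n = length zs
    raise : suc n + z ≤ n + z′
    raise = ≤-trans (≤-reflexive (sym (+-suc n z))) (+-monoʳ-≤ n z<z′)
  ... | inj₂ refl = s≤s (begin
    suc n + d * (suc n + z)   ≡⟨ cong (suc n +_) (*-suc d (n + z)) ⟩
    suc n + (d + d * (n + z)) ≡⟨ regroup ⟩
    d + suc n + d * (n + z)   ≤⟨ run-bound d p run z∉ sep xs≤K ⟩
    length xs + d * K         ∎)
    where
    open ≤-Reasoning
    n : ℕ
    n = length zs
    regroup : suc n + (d + d * (n + z)) ≡ d + suc n + d * (n + z)
    regroup = trans (sym (+-assoc (suc n) d _)) (cong (_+ d * (n + z)) (+-comm (suc n) d))

  upRun-bound : ∀ {K m xs} → HasUpRun m xs → Separated xs → All (λ y → 1 ≤ y × y ≤ K) xs →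
                suc d * m ≤ length xs + d * K
  upRun-bound ([] , _ , refl , _) _ _ = ≤-trans (≤-reflexive (*-zeroʳ (suc d))) z≤n
  upRun-bound {K} {xs = xs} (z ∷ zs , p , refl , run) sep values = begin
    suc n + d * suc n   ≤⟨ +-monoʳ-≤ (suc n) (*-monoʳ-≤ d 1+n≤n+z) ⟩
    suc n + d * (n + z) ≤⟨ run-bound 0 p run [] sep (All.map proj₂ values) ⟩
    length xs + d * K   ∎
    where
    open ≤-Reasoning
    n : ℕ
    n = length zs
    1+n≤n+z : suc n ≤ n + z
    1+n≤n+z = ≤-trans (≤-reflexive (+-comm 1 n)) (+-monoʳ-≤ n (proj₁ (All.head (All-resp-⊆ p values))))

  forcing-bound : ∀ {m k n xs} → d + d < k ∸ 1 → AForces m k n xs → Separated xs →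
                  All (λ y → 1 ≤ y × y ≤ k ∸ 1) xs → suc d * m ≤ length xs + n + d * (k ∸ 1)
  forcing-bound {n = n} {xs} _ (done run) sep values =
    ≤-trans (upRun-bound run sep values) (+-monoˡ-≤ _ (m≤m+n (length xs) n))
  forcing-bound {m} {k} {suc n} {xs} d+d<k∸1 (move i respond) sep values
    with fresh-value (k ∸ 1) (nearby xs i) (≤-<-trans (length-nearby≤d+d xs i) d+d<k∸1)
  ... | y , (1≤y , y≤K) , y∉ = begin
    suc d * m                                  ≤⟨ forcing-bound d+d<k∸1 (respond y 1≤y y≤K) sep′ values′ ⟩
    length (insertAt xs i y) + n + d * (k ∸ 1) ≡⟨ cong (λ l → l + n + d * (k ∸ 1)) (length-insertAt xs i y) ⟩
    suc (length xs) + n + d * (k ∸ 1)          ≡⟨ cong (_+ d * (k ∸ 1)) (sym (+-suc (length xs) n)) ⟩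
    length xs + suc n + d * (k ∸ 1)            ∎
    where
    open ≤-Reasoning
    sep′ : Separated (insertAt xs i y)
    sep′ = insertAt-separated xs i sep (¬Any⇒All¬ (nearby xs i) y∉)
    values′ : All (λ y → 1 ≤ y × y ≤ k ∸ 1) (insertAt xs i y)
    values′ = All-insertAt xs i values (1≤y , y≤K)

open import Data.Integer using (ℤ; +_; _+_; _-_; _*_)
import Data.Integer as ℤ
import Data.Nat as ℕ
open import Data.Nat.DivMod using (m/n≡1+[m∸n]/n; m/n*n≤m)
open import Data.Integer.Properties using (pos-*; +-monoˡ-≤; +-assoc; +-inverseʳ; +-identityʳ; module ≤-Reasoning)
open import Data.Integer.Tactic.RingSolver using (solve-∀)

i≤j+k⇒i-k≤j : ∀ {i j k : ℤ} → i ℤ.≤ j + k → i - k ℤ.≤ j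
i≤j+k⇒i-k≤j {i} {j} {k} i≤j+k = begin
  i - k           ≤⟨ +-monoˡ-≤ (ℤ.- k) i≤j+k ⟩
  j + k - k       ≡⟨ +-assoc j k (ℤ.- k) ⟩
  j + (k - k)     ≡⟨ cong (λ x → j + x) (+-inverseʳ k) ⟩
  j + + 0         ≡⟨ +-identityʳ j ⟩
  j               ∎
  where open ≤-Reasoning

bound-in-ℤ : ∀ {d c m n : ℕ} → suc d ℕ.* m ≤ n ℕ.+ d ℕ.* c →
             + suc d * (+ m - + suc c + + 1) + + suc c - + 1 ℤ.≤ + n
bound-in-ℤ {d} {c} {m} {n} dm≤n+dc = begin
  + suc d * (+ m - + suc c + + 1) + + suc c - + 1 ≡⟨ expand (+ d) (+ c) (+ m) ⟩
  + suc d * + m - + d * + c                       ≡⟨ cong₂ _-_ (sym (pos-* (suc d) m)) (sym (pos-* d c)) ⟩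
  + (suc d ℕ.* m) - + (d ℕ.* c)                   ≤⟨ i≤j+k⇒i-k≤j {k = + (d ℕ.* c)} (ℤ.+≤+ dm≤n+dc) ⟩
  + n                                             ∎
  where
  open ≤-Reasoning
  expand : ∀ D C M → (+ 1 + D) * (M - (+ 1 + C) + + 1) + (+ 1 + C) - + 1 ≡ (+ 1 + D) * M - D * C
  expand = solve-∀

-- The bound also holds for m = 0.
proposition2 : ∀ (m k : ℕ) → 1 ≤ m → 2 ≤ k → ∀ (n : ℕ) → AForces m k n [] →
    (+ (k / 2)) * (+ m - + k + + 1) + + k - + 1 ℤ.≤ + n
proposition2 m zero          _ ()
proposition2 m (suc zero)    _ (s≤s ())
proposition2 m k@(suc (suc k′)) _ _ n forces =
  subst (λ h → + h * (+ m - + k + + 1) + + k - + 1 ℤ.≤ + n) (sym k/2≡1+d)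
    (bound-in-ℤ {d} {suc k′} {m} {n} (forcing-bound (s≤s 2d≤k′) forces [] []))
  where
  d : ℕ
  d = k′ / 2
  open Separation d using (forcing-bound; [])
  k/2≡1+d : k / 2 ≡ suc d
  k/2≡1+d = m/n≡1+[m∸n]/n {k} {2} (s≤s (s≤s z≤n))
  2d≤k′ : d ℕ.+ d ≤ k′
  2d≤k′ = subst (_≤ k′) (trans (*-suc d 1) (cong (d ℕ.+_) (*-identityʳ d))) (m/n*n≤m k′ 2)
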